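{- Let $\mathcal{F}$ be a finite collection of graphs, let $G$ be a graph and let $k\in\mathbb{N}$ be such that ${\sf ed}_{{\sf exc}(\mathcal{F})}(G)\le k$. Then the complete graph $K_{s_\mathcal{F}+k}$ is not a minor of $G$.
   Context: ${\sf exc}(\mathcal{F})$ is the class of graphs containing no graph of $\mathcal{F}$ as a minor; $s_\mathcal{F}=\max\{|V(H)|\mid H\in\mathcal{F}\}$. The elimination distance ${\sf ed}_{\mathcal{G}}(G)$ is $0$ if $G\in\mathcal{G}$; $1+\min_{v\in V(G)}{\sf ed}_{\mathcal{G}}(G\setminus v)$ if $G\notin\mathcal{G}$ is connected; and the maximum over connected components otherwise. -}

module Defs where

open import Level using (Level; 0ℓ) renaming (suc to lsuc)
open import Data.Nat using (ℕ; zero; suc; _⊔_)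
open import Data.Fin using (Fin; _≟_)
open import Data.Bool using (Bool; true; false; not)
open import Data.List using (List; foldr; map)
open import Data.List.Relation.Unary.All using (All)
open import Data.Product using (Σ; ∃; _×_; _,_)
open import Relation.Nullary using (¬_; yes; no)
open import Relation.Nullary.Decidable using (⌊_⌋)
open import Relation.Binary.PropositionalEquality using (_≡_; _≢_; refl; sym)

record Graph : Set where
  field
    n      : ℕ
    adj    : Fin n → Fin n → Bool
    symm   : ∀ i j → adj i j ≡ adj j i
    irrefl : ∀ i → adj i i ≡ false
open Graph public

Edge : (G : Graph) → Fin (n G) → Fin (n G) → Set
Edge G x y = adj G x y ≡ true

-- Vertex subsets are predicates; a subset U of V(G) stands for the
-- induced subgraph G[U].  The whole graph G is G[λ _ → ⊤].
VSet : Graph → Set₁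
VSet G = Fin (n G) → Set

data Walk (G : Graph) (U : VSet G) : Fin (n G) → Fin (n G) → Set where
  here : ∀ {x} → U x → Walk G U x x
  step : ∀ {x y z} → U x → Edge G x y → Walk G U y z → Walk G U x z

Connected : (G : Graph) → VSet G → Set
Connected G U = (∃ λ x → U x) × (∀ x y → U x → U y → Walk G U x y)

Component : (G : Graph) → VSet G → Fin (n G) → VSet G
Component G U x y = U y × Walk G U x y

Delete : (G : Graph) → VSet G → Fin (n G) → VSet G
Delete G U v x = U x × x ≢ v

record MinorModel (H G : Graph) (U : VSet G) : Set₁ where
  field
    branch   : Fin (n H) → VSet G
    inside   : ∀ u x → branch u x → U x
    nonempty : ∀ u → ∃ λ x → branch u x
    disjoint : ∀ u w x → branch u x → branch w x → u ≡ w
    conn     : ∀ u → Connected G (branch u)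
    edges    : ∀ u w → Edge H u w →
               ∃ λ x → ∃ λ y → branch u x × branch w y × Edge G x y

IsMinor : (H G : Graph) → VSet G → Set₁
IsMinor H G U = MinorModel H G U

Exc : List Graph → (G : Graph) → VSet G → Set₁
Exc F G U = All (λ H → ¬ IsMinor H G U) F

sF : List Graph → ℕ
sF F = foldr _⊔_ 0 (map n F)

-- "ed_𝒢(G[U]) ≤ k", where 𝒢 is a class of graphs given by the predicate
-- Cls on induced subgraphs of G, following the recursive definition:
--  * ed = 0 if G[U] ∈ 𝒢;
--  * ed = 1 + min_v ed(G[U] - v) if G[U] ∉ 𝒢 is connected;
--  * ed = max over the connected components otherwise.
data EdLe (G : Graph) (Cls : VSet G → Set₁) : VSet G → ℕ → Set₁ where
  base : ∀ {U k} → Cls U → EdLe G Cls U k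
  del  : ∀ {U k} → ¬ Cls U → Connected G U →
         (v : Fin (n G)) → U v → EdLe G Cls (Delete G U v) k →
         EdLe G Cls U (suc k)
  comp : ∀ {U k} → ¬ Cls U → ¬ Connected G U →
         (∀ x → U x → EdLe G Cls (Component G U x) k) →
         EdLe G Cls U k

private
  neq : ∀ {m} (i j : Fin m) → Bool
  neq i j = not ⌊ i ≟ j ⌋

  neq-sym : ∀ {m} (i j : Fin m) → neq i j ≡ neq j i
  neq-sym i j with i ≟ j | j ≟ i
  ... | yes _ | yes _ = refl
  ... | no _  | no _  = refl
  ... | yes p | no q  with q (sym p)
  ... | ()
  neq-sym i j | no p | yes q with p (sym q)
  ... | ()

  neq-irr : ∀ {m} (i : Fin m) → neq i i ≡ false
  neq-irr i with i ≟ i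
  ... | yes _ = refl
  ... | no p with p refl
  ... | ()

K : ℕ → Graph
K m = record { n = m ; adj = neq ; symm = neq-sym ; irrefl = neq-irr }

{-# OPTIONS --safe #-}
module Submission where

-- A K_(s+k) model cannot survive the elimination process: deleting a vertex
-- destroys at most one branch set, so K_(m+1) in G[U] leaves K_m in G[U] - v;
-- the branch sets of a complete-graph model are pairwise adjacent, so the whole
-- model sits inside one connected component; and at a leaf G[U] ∈ exc(F)
-- excludes every H ∈ F, hence K_m for every m ≥ |V(H)|, in particular m ≥ s_F.

open import Defs
open import Data.Nat using (ℕ; suc; _+_; _≤_)
open import Data.Nat.Properties using (+-suc; m≤m⊔n; m≤m+n; ≤-trans)
open import Data.List using (List; []; _∷_)
open import Data.List.Relation.Unary.All using (All; _∷_)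
open import Data.Unit using (⊤)
open import Data.Product using (∃; _×_; _,_; proj₁; proj₂)
open import Data.Empty using (⊥-elim)
open import Data.Fin using (Fin; _≟_; punchIn; inject≤; fromℕ<)
import Data.Fin as Fin
open import Data.Fin.Properties using (punchIn-injective; punchInᵢ≢i; inject≤-injective; suc-injective)
open import Function.Definitions using (Injective)
open import Relation.Nullary using (¬_; yes; no; Dec)
open import Relation.Nullary.Decidable.Core using (¬¬-excluded-middle)
open import Relation.Binary.PropositionalEquality using (_≢_; _≡_; refl; sym; trans)

K-edge : ∀ {m} {i j : Fin m} → i ≢ j → Edge (K m) i j
K-edge {i = i} {j} i≢j with i ≟ j
... | yes i≡j = ⊥-elim (i≢j i≡j)
... | no _    = refl

Edge⇒≢ : (H : Graph) {u w : Fin (n H)} → Edge H u w → u ≢ w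
Edge⇒≢ H {u} e refl with trans (sym e) (irrefl H u)
... | ()

module _ {G : Graph} where

  Walk-mono : {U U′ : VSet G} → (∀ x → U x → U′ x) →
              ∀ {x y} → Walk G U x y → Walk G U′ x y
  Walk-mono U⊆U′ (here ux)       = here (U⊆U′ _ ux)
  Walk-mono U⊆U′ (step ux e walk) = step (U⊆U′ _ ux) e (Walk-mono U⊆U′ walk)

  Walk-++ : {U : VSet G} {x y z : Fin (n G)} →
            Walk G U x y → Walk G U y z → Walk G U x z
  Walk-++ (here _)         walk′ = walk′
  Walk-++ (step ux e walk) walk′ = step ux e (Walk-++ walk walk′)

  open MinorModel

  K-model⇒model : ∀ {m} {U : VSet G} (M : MinorModel (K m) G U)
    (H : Graph) (f : Fin (n H) → Fin m) → Injective _≡_ _≡_ f →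
    (U′ : VSet G) → (∀ i x → branch M (f i) x → U′ x) → MinorModel H G U′
  K-model⇒model M H f f-inj U′ inside′ = record
    { branch   = λ u → branch M (f u)
    ; inside   = inside′
    ; nonempty = λ u → nonempty M (f u)
    ; disjoint = λ u w x bu bw → f-inj (disjoint M (f u) (f w) x bu bw)
    ; conn     = λ u → conn M (f u)
    ; edges    = λ u w e → edges M (f u) (f w) (K-edge (λ fu≡fw → Edge⇒≢ H e (f-inj fu≡fw)))
    }

  K-minor-mono : ∀ {m} {U : VSet G} (H : Graph) → n H ≤ m →
                 IsMinor (K m) G U → IsMinor H G U
  K-minor-mono {U = U} H nH≤m M =
    K-model⇒model M H (λ i → inject≤ i nH≤m) (inject≤-injective _ _ _ _)
                  U (λ _ → inside M _)

  -- Whether v lies in some branch set is not decidable, so the case split is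
  -- made under a double negation; this is why the conclusion is negative.
  K-minor-delete : ∀ {m} {U : VSet G} (v : Fin (n G)) →
    ¬ IsMinor (K m) G (Delete G U v) → ¬ IsMinor (K (suc m)) G U
  K-minor-delete {m} {U} v ¬M M = ¬¬-excluded-middle split
    where
    split : ¬ Dec (∃ λ u → branch M u v)
    split (yes (u , v∈u)) = ¬M (K-model⇒model M (K m) (punchIn u)
      (punchIn-injective u _ _) _
      (λ i x x∈i → inside M _ x x∈i ,
                   λ { refl → punchInᵢ≢i u i (disjoint M _ _ v x∈i v∈u) }))
    split (no v∉M) = ¬M (K-model⇒model M (K m) Fin.suc suc-injective _
      (λ i x x∈i → inside M _ x x∈i , λ { refl → v∉M (_ , x∈i) }))

  K-model-in-component : ∀ {m} {U : VSet G} → Fin m → MinorModel (K m) G U →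
    ∃ λ x → U x × MinorModel (K m) G (Component G U x)
  K-model-in-component {m} {U} z M = x₀ , inside M z x₀ x₀∈z , record
    { branch   = branch M
    ; inside   = λ u y y∈u → inside M u y y∈u , walk-from-x₀ u y y∈u
    ; nonempty = nonempty M
    ; disjoint = disjoint M
    ; conn     = conn M
    ; edges    = edges M
    }
    where
    x₀   = proj₁ (nonempty M z)
    x₀∈z = proj₂ (nonempty M z)

    walk-in : ∀ u {x y} → branch M u x → branch M u y → Walk G U x y
    walk-in u x∈u y∈u = Walk-mono (inside M u) (proj₂ (conn M u) _ _ x∈u y∈u)

    walk-from-x₀ : ∀ u y → branch M u y → Walk G U x₀ y
    walk-from-x₀ u y y∈u with z ≟ u
    ... | yes refl = walk-in z x₀∈z y∈u
    ... | no z≢u with edges M z u (K-edge z≢u)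
    ... | a , c , a∈z , c∈u , e =
      Walk-++ (walk-in z x₀∈z a∈z) (step (inside M z a a∈z) e (walk-in u c∈u y∈u))

  EdLe⇒¬K-minor : {Cls : VSet G → Set₁} (s : ℕ) → 1 ≤ s →
    (∀ {U} → Cls U → ¬ IsMinor (K s) G U) →
    ∀ {U k} → EdLe G Cls U k → ¬ IsMinor (K (s + k)) G U
  EdLe⇒¬K-minor s 1≤s ¬K {k = k} (base inCls) M =
    ¬K inCls (K-minor-mono (K s) (m≤m+n s k) M)
  EdLe⇒¬K-minor s 1≤s ¬K {k = suc k} (del _ _ v _ ed) M rewrite +-suc s k =
    K-minor-delete v (EdLe⇒¬K-minor s 1≤s ¬K ed) M
  EdLe⇒¬K-minor s 1≤s ¬K {k = k} (comp _ _ ed) M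
    with K-model-in-component (fromℕ< (≤-trans 1≤s (m≤m+n s k))) M
  ... | x , x∈U , M′ = EdLe⇒¬K-minor s 1≤s ¬K (ed x x∈U) M′

lemma4p2 : (F : List Graph) → F ≢ [] → All (λ H → 1 ≤ n H) F →
    (G : Graph) (k : ℕ) →
    EdLe G (Exc F G) (λ _ → ⊤) k →
    ¬ IsMinor (K (sF F + k)) G (λ _ → ⊤)
lemma4p2 []       F≢[] _           G k ed = ⊥-elim (F≢[] refl)
lemma4p2 (H ∷ F′) _    (1≤nH ∷ _) G k ed =
  EdLe⇒¬K-minor (sF (H ∷ F′)) (≤-trans 1≤nH nH≤s) excludes-K ed
  where
  nH≤s : n H ≤ sF (H ∷ F′)
  nH≤s = m≤m⊔n (n H) (sF F′)

  excludes-K : ∀ {U} → Exc (H ∷ F′) G U → ¬ IsMinor (K (sF (H ∷ F′))) G U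
  excludes-K (¬H ∷ _) M = ¬H (K-minor-mono H nH≤s M)
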